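{- Let $p$ and $q$ be positive coprime integers with $p\geqslant 59\,q$, and let $$Q_{pq}(t)=t^{10}+(2q^2+p^2)(3q^2-2p^2)\,t^8+(q^8+10p^2q^6+4p^4q^4-14p^6q^2+p^8)\,t^6-p^2q^2(q^8-14p^2q^6+4p^4q^4+10p^6q^2+p^8)\,t^4-p^6q^6(q^2+2p^2)(3p^2-2q^2)\,t^2-q^{10}p^{10}.$$ Then the equation $Q_{pq}(t)=0$ has at least one real root $t$ satisfying $$p^2+2qp-2q^2<t<p^2+2qp-2q^2+\frac{9q^3}{p}.$$ -}

module Defs where

open import Data.Nat as ℕ using (ℕ; zero; suc)
open import Data.Integer as ℤ using (ℤ; +_)
open import Data.Rational using (ℚ; _+_; _*_; _-_; -_; ∣_∣; _≤_; _<_; _/_; 0ℚ; 1ℚ)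
open import Data.Product using (Σ; ∃; _×_)

ℤ→ℚ : ℤ → ℚ
ℤ→ℚ z = z / 1

ℕ→ℚ : ℕ → ℚ
ℕ→ℚ n = (+ n) / 1

inv1+ : ℕ → ℚ
inv1+ n = (+ 1) / suc n

_^ᵠ_ : ℚ → ℕ → ℚ
x ^ᵠ zero = 1ℚ
x ^ᵠ suc n = x * (x ^ᵠ n)
infixr 8 _^ᵠ_

-- Real numbers à la Bishop: regular Cauchy sequences of rationals,
-- |x m - x n| ≤ 1/(m+1) + 1/(n+1).
record ℝ : Set where
  field
    seq : ℕ → ℚ
    reg : ∀ m n → ∣ seq m - seq n ∣ ≤ inv1+ m + inv1+ n
open ℝ public

_<ʳ_ : ℚ → ℝ → Set
a <ʳ x = ∃ λ n → a + inv1+ n < seq x n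

_ʳ<_ : ℝ → ℚ → Set
x ʳ< b = ∃ λ n → seq x n + inv1+ n < b

-- f(x) = 0 for a (continuous, here polynomial) function f : ℚ → ℚ extended to ℝ:
-- f(x n) → 0.
IsRootOf : (ℚ → ℚ) → ℝ → Set
IsRootOf f x = ∀ k → ∃ λ N → ∀ n → N ℕ.≤ n → ∣ f (seq x n) ∣ ≤ inv1+ k

Qpq : ℕ → ℕ → ℚ → ℚ
Qpq p′ q′ t =
    t ^ᵠ 10
  + ((ℕ→ℚ 2 * q ^ᵠ 2 + p ^ᵠ 2) * (ℕ→ℚ 3 * q ^ᵠ 2 - ℕ→ℚ 2 * p ^ᵠ 2)) * t ^ᵠ 8
  + (q ^ᵠ 8 + ℕ→ℚ 10 * p ^ᵠ 2 * q ^ᵠ 6 + ℕ→ℚ 4 * p ^ᵠ 4 * q ^ᵠ 4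
       - ℕ→ℚ 14 * p ^ᵠ 6 * q ^ᵠ 2 + p ^ᵠ 8) * t ^ᵠ 6
  - (p ^ᵠ 2 * q ^ᵠ 2 * (q ^ᵠ 8 - ℕ→ℚ 14 * p ^ᵠ 2 * q ^ᵠ 6 + ℕ→ℚ 4 * p ^ᵠ 4 * q ^ᵠ 4
       + ℕ→ℚ 10 * p ^ᵠ 6 * q ^ᵠ 2 + p ^ᵠ 8)) * t ^ᵠ 4
  - (p ^ᵠ 6 * q ^ᵠ 6 * (q ^ᵠ 2 + ℕ→ℚ 2 * p ^ᵠ 2) * (ℕ→ℚ 3 * p ^ᵠ 2 - ℕ→ℚ 2 * q ^ᵠ 2)) * t ^ᵠ 2
  - q ^ᵠ 10 * p ^ᵠ 10
  where
    p = ℕ→ℚ p′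
    q = ℕ→ℚ q′

lowerB : ℕ → ℕ → ℚ
lowerB p′ q′ = p ^ᵠ 2 + ℕ→ℚ 2 * q * p - ℕ→ℚ 2 * q ^ᵠ 2
  where
    p = ℕ→ℚ p′
    q = ℕ→ℚ q′

upperB : (p q : ℕ) → .{{ℕ.NonZero p}} → ℚ
upperB p q = lowerB p q + (+ (9 ℕ.* q ℕ.^ 3)) / p

{-# OPTIONS --safe #-}
module Submission where

-- Write p = q (59 + r) with r ≥ 0.  Q is weighted homogeneous, Q (λp) (λq) (λ²t) = λ²⁰ Q p q t, so
-- at both ends of the interval [L, L + 9q³/p] the value of Q is, up to a positive factor, a
-- polynomial in r alone; expanded, the one at L has only negative and the one at L + 9q³/p only
-- positive coefficients.  On this interval, which lies in [0, ∞), Q is Lipschitz, so bisection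
-- converges with an explicit modulus to a real root strictly between the two ends.

open import Defs
open import Data.Nat as ℕ using (ℕ; zero; suc; NonZero)
import Data.Nat.Properties as ℕP
open import Data.Nat.Coprimality using (Coprime)
open import Data.Integer as ℤ using (+_; +0; +[1+_]; -[1+_])
import Data.Integer.Properties as ℤP
open import Data.Rational as ℚ using (ℚ; mkℚ; _+_; _*_; _-_; -_; ∣_∣; _≤_; _<_; _/_; 0ℚ; 1ℚ; ½; 1/_; toℚᵘ)
import Data.Rational.Properties as ℚP
open import Data.Rational.Unnormalised as ℚᵘ using (mkℚᵘ; *≤*; *<*)
import Data.Rational.Unnormalised.Properties as ℚᵘP
open import Algebra.Bundles using (CommutativeRing)
open import Algebra.Solver.Ring.AlmostCommutativeRing using (AlmostCommutativeRing; _-Raw-AlmostCommutative⟶_; fromCommutativeRing)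
import Algebra.Solver.Ring as RingSolver
open import Data.Maybe as Maybe using (Maybe; From-just; from-just)
open import Data.Fin using (#_)
open import Data.List as List using (List; []; _∷_)
open import Data.Vec using ([]; _∷_)
open import Data.Product using (Σ; ∃; _×_; _,_; proj₁; proj₂)
open import Data.Sum using (_⊎_; inj₁; inj₂; [_,_]′)
open import Function using (flip)
open import Relation.Binary.Definitions using (Reflexive; Transitive)
open import Relation.Nullary using (yes; no)
open import Relation.Nullary.Decidable using (dec⇒maybe)
open import Relation.Binary.PropositionalEquality
open ℚP.≤-Reasoning

toℚᵘ-/ : ∀ i n → toℚᵘ (i / suc n) ℚᵘ.≃ mkℚᵘ i n
toℚᵘ-/ i n = ℚP.toℚᵘ-fromℚᵘ (mkℚᵘ i n)

ℤ→ℚ-+ : ∀ i j → ℤ→ℚ (i ℤ.+ j) ≡ ℤ→ℚ i + ℤ→ℚ j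
ℤ→ℚ-+ i j = ℚP.toℚᵘ-injective
  (ℚᵘP.≃-trans (toℚᵘ-/ (i ℤ.+ j) 0)
  (ℚᵘP.≃-trans (ℚᵘ.*≡* (cong₂ (λ a b → (a ℤ.+ b) ℤ.* + 1) (sym (ℤP.*-identityʳ i)) (sym (ℤP.*-identityʳ j))))
  (ℚᵘP.≃-sym (ℚᵘP.≃-trans (ℚP.toℚᵘ-homo-+ (ℤ→ℚ i) (ℤ→ℚ j)) (ℚᵘP.+-cong (toℚᵘ-/ i 0) (toℚᵘ-/ j 0))))))

ℤ→ℚ-* : ∀ i j → ℤ→ℚ (i ℤ.* j) ≡ ℤ→ℚ i * ℤ→ℚ j
ℤ→ℚ-* i j = ℚP.toℚᵘ-injective
  (ℚᵘP.≃-trans (toℚᵘ-/ (i ℤ.* j) 0)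
  (ℚᵘP.≃-sym (ℚᵘP.≃-trans (ℚP.toℚᵘ-homo-* (ℤ→ℚ i) (ℤ→ℚ j)) (ℚᵘP.*-cong (toℚᵘ-/ i 0) (toℚᵘ-/ j 0)))))

ℤ→ℚ-neg : ∀ i → ℤ→ℚ (ℤ.- i) ≡ - ℤ→ℚ i
ℤ→ℚ-neg i = ℚP.toℚᵘ-injective
  (ℚᵘP.≃-trans (toℚᵘ-/ (ℤ.- i) 0)
  (ℚᵘP.≃-sym (ℚᵘP.≃-trans (ℚP.toℚᵘ-homo‿- (ℤ→ℚ i)) (ℚᵘP.-‿cong (toℚᵘ-/ i 0)))))

ℚ-ring : AlmostCommutativeRing _ _
ℚ-ring = fromCommutativeRing ℚP.+-*-commutativeRing

ℤ→ℚ-morphism : CommutativeRing.rawRing ℤP.+-*-commutativeRing -Raw-AlmostCommutative⟶ ℚ-ring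
ℤ→ℚ-morphism = record
  { ⟦_⟧ = ℤ→ℚ ; +-homo = ℤ→ℚ-+ ; *-homo = ℤ→ℚ-* ; -‿homo = ℤ→ℚ-neg ; 0-homo = refl ; 1-homo = refl }

open RingSolver (CommutativeRing.rawRing ℤP.+-*-commutativeRing) ℚ-ring ℤ→ℚ-morphism
                (λ i j → Maybe.map (cong ℤ→ℚ) (dec⇒maybe (i ℤ.≟ j)))
  using (Polynomial; con; var; _:+_; _:*_; _:-_; :-_; _:^_; ⟦_⟧; solve; _:=_; prove; normalise; _≟N_; ⟦_⟧N-cong)

num : ∀ {n} → ℕ → Polynomial n
num k = con (+ k)

-- Compares normal forms, whose coefficients are integers.  Proving the large identities below by
-- solve … refl instead makes Agda unfold the rational arithmetic and is far slower.
identity? : ∀ {n} (e₁ e₂ : Polynomial n) → Maybe (∀ ρ → ⟦ e₁ ⟧ ρ ≡ ⟦ e₂ ⟧ ρ)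
identity? e₁ e₂ = Maybe.map (λ nf₁≈nf₂ ρ → prove ρ e₁ e₂ (⟦ nf₁≈nf₂ ⟧N-cong ρ)) (normalise e₁ ≟N normalise e₂)

ring-identity : ∀ {n} (e₁ e₂ : Polynomial n) → From-just (identity? e₁ e₂)
ring-identity e₁ e₂ = from-just (identity? e₁ e₂)

p≤p+q : ∀ {p q} → 0ℚ ≤ q → p ≤ p + q
p≤p+q {p} {q} 0≤q = subst (_≤ p + q) (ℚP.+-identityʳ p) (ℚP.+-monoʳ-≤ p 0≤q)

p≤q⇒0≤q-p : ∀ {p q} → p ≤ q → 0ℚ ≤ q - p
p≤q⇒0≤q-p {p} {q} p≤q = subst (_≤ q - p) (ℚP.+-inverseʳ p) (ℚP.+-monoˡ-≤ (- p) p≤q)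

0≤p*q : ∀ {p q} → 0ℚ ≤ p → 0ℚ ≤ q → 0ℚ ≤ p * q
0≤p*q {p} {q} 0≤p 0≤q =
  ℚP.nonNegative⁻¹ _ {{ℚP.nonNeg*nonNeg⇒nonNeg p {{ℚ.nonNegative 0≤p}} q {{ℚ.nonNegative 0≤q}}}}

0<p*q : ∀ {p q} → 0ℚ < p → 0ℚ < q → 0ℚ < p * q
0<p*q {p} {q} 0<p 0<q = ℚP.positive⁻¹ _ {{ℚP.pos*pos⇒pos p {{ℚ.positive 0<p}} q {{ℚ.positive 0<q}}}}

0<p^n : ∀ {p} n → 0ℚ < p → 0ℚ < p ^ᵠ n
0<p^n zero    _   = ℚP.positive⁻¹ 1ℚ
0<p^n (suc n) 0<p = 0<p*q 0<p (0<p^n n 0<p)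

*-mono-≤-nonNeg : ∀ {p q r s} → 0ℚ ≤ p → 0ℚ ≤ r → p ≤ q → r ≤ s → p * r ≤ q * s
*-mono-≤-nonNeg {p} {q} {r} {s} 0≤p 0≤r p≤q r≤s = begin
  p * r ≤⟨ ℚP.*-monoʳ-≤-nonNeg r {{ℚ.nonNegative 0≤r}} p≤q ⟩
  q * r ≤⟨ ℚP.*-monoˡ-≤-nonNeg q {{ℚ.nonNegative (ℚP.≤-trans 0≤p p≤q)}} r≤s ⟩
  q * s ∎

p≤∣p∣ : ∀ p → p ≤ ∣ p ∣
p≤∣p∣ (mkℚ (+ _)      _ _) = ℚP.≤-refl
p≤∣p∣ p@(mkℚ -[1+ _ ] _ _) = ℚP.≤-trans (ℚP.<⇒≤ (ℚP.negative⁻¹ p)) (ℚP.0≤∣p∣ p)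

∣p-q∣≡∣q-p∣ : ∀ p q → ∣ p - q ∣ ≡ ∣ q - p ∣
∣p-q∣≡∣q-p∣ p q = trans (cong ∣_∣ (solve 2 (λ p q → p :- q := :- (q :- p)) refl p q)) (ℚP.∣-p∣≡∣p∣ (q - p))

p≤q≤p+d⇒∣p-q∣≤d : ∀ {p q d} → p ≤ q → q ≤ p + d → ∣ p - q ∣ ≤ d
p≤q≤p+d⇒∣p-q∣≤d {p} {q} {d} p≤q q≤p+d = begin
  ∣ p - q ∣ ≡⟨ ∣p-q∣≡∣q-p∣ p q ⟩
  ∣ q - p ∣ ≡⟨ ℚP.0≤p⇒∣p∣≡p (p≤q⇒0≤q-p p≤q) ⟩
  q - p     ≤⟨ ℚP.+-monoˡ-≤ (- p) q≤p+d ⟩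
  p + d - p ≡⟨ solve 2 (λ p d → p :+ d :- p := d) refl p d ⟩
  d         ∎

0<p*q⇒0<q : ∀ {p q} → 0ℚ ≤ p → 0ℚ < p * q → 0ℚ < q
0<p*q⇒0<q {p} {q} 0≤p 0<pq =
  ℚP.*-cancelˡ-<-nonNeg p {{ℚ.nonNegative 0≤p}} (subst (_< p * q) (sym (ℚP.*-zeroʳ p)) 0<pq)

ratio-decomposition : ∀ c {p q} → 0ℚ < q → c * q ≤ p → ∃ λ r → 0ℚ ≤ r × q * (c + r) ≡ p
ratio-decomposition c {p} {q} 0<q cq≤p = p * q⁻¹ - c , p≤q⇒0≤q-p c≤pq⁻¹ , q[c+r]≡p
  where
  instance
    q≢0 : ℚ.NonZero q
    q≢0 = ℚP.pos⇒nonZero q {{ℚ.positive 0<q}}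
  q⁻¹ : ℚ
  q⁻¹ = 1/ q
  0≤q⁻¹ : 0ℚ ≤ q⁻¹
  0≤q⁻¹ = ℚP.<⇒≤ (ℚP.positive⁻¹ q⁻¹ {{ℚP.1/pos⇒pos q {{ℚ.positive 0<q}}}})
  c≤pq⁻¹ : c ≤ p * q⁻¹
  c≤pq⁻¹ = begin
    c                ≡⟨ sym (ℚP.*-identityʳ c) ⟩
    c * 1ℚ           ≡⟨ cong (_*_ c) (sym (ℚP.*-inverseʳ q)) ⟩
    c * (q * q⁻¹)    ≡⟨ sym (ℚP.*-assoc c q q⁻¹) ⟩
    c * q * q⁻¹      ≤⟨ ℚP.*-monoʳ-≤-nonNeg q⁻¹ {{ℚ.nonNegative 0≤q⁻¹}} cq≤p ⟩
    p * q⁻¹          ∎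
  q[c+r]≡p : q * (c + (p * q⁻¹ - c)) ≡ p
  q[c+r]≡p = begin-equality
    q * (c + (p * q⁻¹ - c))  ≡⟨ solve 4 (λ q c p i → q :* (c :+ (p :* i :- c)) := p :* (q :* i)) refl q c p q⁻¹ ⟩
    p * (q * q⁻¹)            ≡⟨ cong (_*_ p) (ℚP.*-inverseʳ q) ⟩
    p * 1ℚ                   ≡⟨ ℚP.*-identityʳ p ⟩
    p                        ∎

ratio-elim : ∀ (P : ℚ → Set) c {p q} → 0ℚ < q → c * q ≤ p → (∀ r → 0ℚ ≤ r → P (q * (c + r))) → P p
ratio-elim P c 0<q cq≤p P[q[c+r]] =
  let r , 0≤r , q[c+r]≡p = ratio-decomposition c 0<q cq≤p in subst P q[c+r]≡p (P[q[c+r]] r 0≤r)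

/-mono-≤ : ∀ {a c} m n .{{_ : NonZero m}} .{{_ : NonZero n}} →
           a ℕ.* n ℕ.≤ c ℕ.* m → (+ a) / m ≤ (+ c) / n
/-mono-≤ {a} {c} (suc m) (suc n) an≤cm = ℚP.toℚᵘ-cancel-≤
  (ℚᵘP.≤-respˡ-≃ (ℚᵘP.≃-sym (toℚᵘ-/ (+ a) m)) (ℚᵘP.≤-respʳ-≃ (ℚᵘP.≃-sym (toℚᵘ-/ (+ c) n))
    (*≤* (subst₂ ℤ._≤_ (ℤP.pos-* a (suc n)) (ℤP.pos-* c (suc m)) (ℤ.+≤+ an≤cm)))))

/-mono-< : ∀ {a c} m n .{{_ : NonZero m}} .{{_ : NonZero n}} →
           a ℕ.* n ℕ.< c ℕ.* m → (+ a) / m < (+ c) / n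
/-mono-< {a} {c} (suc m) (suc n) an<cm = ℚP.toℚᵘ-cancel-<
  (ℚᵘP.<-respˡ-≃ (ℚᵘP.≃-sym (toℚᵘ-/ (+ a) m)) (ℚᵘP.<-respʳ-≃ (ℚᵘP.≃-sym (toℚᵘ-/ (+ c) n))
    (*<* (subst₂ ℤ._<_ (ℤP.pos-* a (suc n)) (ℤP.pos-* c (suc m)) (ℤ.+<+ an<cm)))))

/-* : ∀ a c m n .{{_ : NonZero m}} .{{_ : NonZero n}} →
      ((+ a) / m) * ((+ c) / n) ≡ ((+ (a ℕ.* c)) / (m ℕ.* n)) {{ℕP.m*n≢0 m n}}
/-* a c (suc m) (suc n) = ℚP.toℚᵘ-injective
  (ℚᵘP.≃-trans (ℚP.toℚᵘ-homo-* ((+ a) / suc m) ((+ c) / suc n))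
  (ℚᵘP.≃-trans (ℚᵘP.*-cong (toℚᵘ-/ (+ a) m) (toℚᵘ-/ (+ c) n))
  (ℚᵘP.≃-trans (ℚᵘ.*≡* (cong (ℤ._* + suc (n ℕ.+ m ℕ.* suc n)) (sym (ℤP.pos-* a c))))
               (ℚᵘP.≃-sym (toℚᵘ-/ (+ (a ℕ.* c)) (n ℕ.+ m ℕ.* suc n))))))

ℕ→ℚ-mono-≤ : ∀ {m n} → m ℕ.≤ n → ℕ→ℚ m ≤ ℕ→ℚ n
ℕ→ℚ-mono-≤ {m} {n} m≤n = /-mono-≤ {m} {n} 1 1 (subst₂ ℕ._≤_ (sym (ℕP.*-identityʳ m)) (sym (ℕP.*-identityʳ n)) m≤n)

ℕ→ℚ-* : ∀ m n → ℕ→ℚ (m ℕ.* n) ≡ ℕ→ℚ m * ℕ→ℚ n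
ℕ→ℚ-* m n = sym (/-* m n 1 1)

ℕ→ℚ-^ : ∀ m n → ℕ→ℚ (m ℕ.^ n) ≡ ℕ→ℚ m ^ᵠ n
ℕ→ℚ-^ m zero    = refl
ℕ→ℚ-^ m (suc n) = trans (ℕ→ℚ-* m (m ℕ.^ n)) (cong (ℕ→ℚ m *_) (ℕ→ℚ-^ m n))

ℕ→ℚ-*-/ : ∀ m n .{{_ : NonZero n}} → ℕ→ℚ n * ((+ m) / n) ≡ ℕ→ℚ m
ℕ→ℚ-*-/ m n = trans (/-* n m 1 n) (ℚP.≤-antisym (/-mono-≤ {n ℕ.* m} {m} (1 ℕ.* n) 1 {{1n≢0}} (ℕP.≤-reflexive eq))
                                                (/-mono-≤ {m} {n ℕ.* m} 1 (1 ℕ.* n) {{_}} {{1n≢0}} (ℕP.≤-reflexive (sym eq))))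
  where
  eq : n ℕ.* m ℕ.* 1 ≡ m ℕ.* (1 ℕ.* n)
  eq = trans (ℕP.*-identityʳ (n ℕ.* m)) (trans (ℕP.*-comm n m) (cong (m ℕ.*_) (sym (ℕP.*-identityˡ n))))
  1n≢0 : NonZero (1 ℕ.* n)
  1n≢0 = ℕP.m*n≢0 1 n

0≤ℕ→ℚ : ∀ n → 0ℚ ≤ ℕ→ℚ n
0≤ℕ→ℚ n = ℚP.nonNegative⁻¹ _ {{ℚP.normalize-nonNeg n 1}}

0<ℕ→ℚ : ∀ n → 0ℚ < ℕ→ℚ (suc n)
0<ℕ→ℚ n = ℚP.positive⁻¹ _ {{ℚP.normalize-pos (suc n) 1}}

0<inv1+ : ∀ n → 0ℚ < inv1+ n
0<inv1+ n = ℚP.positive⁻¹ _ {{ℚP.normalize-pos 1 (suc n)}}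

inv1+-antitone : ∀ {m n} → m ℕ.≤ n → inv1+ n ≤ inv1+ m
inv1+-antitone m≤n = /-mono-≤ {1} {1} _ _ (ℕP.*-monoʳ-≤ 1 (ℕ.s≤s m≤n))

inv1+-halve : ∀ n → inv1+ n * ½ ≤ inv1+ (suc n)
inv1+-halve n = subst (_≤ inv1+ (suc n)) (sym (/-* 1 1 (suc n) 2))
  (/-mono-≤ {1 ℕ.* 1} {1} (suc n ℕ.* 2) (suc (suc n)) (ℕP.*-monoʳ-≤ 1 (ℕ.s≤s (ℕ.s≤s (ℕP.m≤m*n n 2)))))

ℕ-above : ∀ r → ∃ λ m → r ≤ ℕ→ℚ (suc m)
ℕ-above (mkℚ n d _) = ℤ.∣ n ∣ , ℚP.toℚᵘ-cancel-≤ (ℚᵘP.≤-respʳ-≃ (ℚᵘP.≃-sym (toℚᵘ-/ (+ suc ℤ.∣ n ∣) 0)) (*≤* (bound n)))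
  where
  bound : ∀ n → n ℤ.* + 1 ℤ.≤ + suc ℤ.∣ n ∣ ℤ.* + suc d
  bound (+ k)    = subst₂ ℤ._≤_ (ℤP.pos-* k 1) (ℤP.pos-* (suc k) (suc d))
                     (ℤ.+≤+ (ℕP.≤-trans (ℕP.≤-reflexive (ℕP.*-identityʳ k))
                                       (ℕP.≤-trans (ℕP.n≤1+n k) (ℕP.m≤m*n (suc k) (suc d)))))
  bound -[1+ k ] = ℤ.-≤+

inv1+-below : ∀ s → 0ℚ < s → ∃ λ d → inv1+ d ≤ s
inv1+-below (mkℚ +[1+ k ] d _) _ =
  d , ℚP.toℚᵘ-cancel-≤ (ℚᵘP.≤-respˡ-≃ (ℚᵘP.≃-sym (toℚᵘ-/ (+ 1) d))
        (*≤* (ℤP.*-monoʳ-≤-nonNeg (+ suc d) {+ 1} {+[1+ k ]} (ℤ.+≤+ (ℕ.s≤s ℕ.z≤n)))))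
inv1+-below (mkℚ +0       _ _) 0<0 with () ← ℚ.positive 0<0
inv1+-below (mkℚ -[1+ _ ] _ _) 0<s with () ← ℚ.positive 0<s

archimedean : ∀ r s → 0ℚ < s → ∃ λ n → r * inv1+ n < s
archimedean r s 0<s with ℕ-above r | inv1+-below s 0<s
... | m , r≤m+1 | d , 1/d+1≤s = n , (begin-strict
  r * inv1+ n                             ≤⟨ ℚP.*-monoʳ-≤-nonNeg (inv1+ n) {{ℚ.nonNegative (ℚP.<⇒≤ (0<inv1+ n))}} r≤m+1 ⟩
  ℕ→ℚ (suc m) * inv1+ n                   ≡⟨ /-* (suc m) 1 1 (suc n) ⟩
  (+ (suc m ℕ.* 1)) / (1 ℕ.* suc n)        <⟨ /-mono-< {suc m ℕ.* 1} {1} (1 ℕ.* suc n) (suc d) cross ⟩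
  inv1+ d                                 ≤⟨ 1/d+1≤s ⟩
  s                                       ∎)
  where
  n : ℕ
  n = suc m ℕ.* suc d
  cross : suc m ℕ.* 1 ℕ.* suc d ℕ.< 1 ℕ.* (1 ℕ.* suc n)
  cross = subst₂ ℕ._<_ (sym (cong (ℕ._* suc d) (ℕP.*-identityʳ (suc m))))
                       (sym (trans (ℕP.*-identityˡ _) (ℕP.*-identityˡ _))) (ℕP.n<1+n n)

halving-bound : (e : ℕ → ℚ) → 0ℚ ≤ e 0 → (∀ n → e (suc n) ≡ e n * ½) → ∀ n → e n ≤ e 0 * inv1+ n
halving-bound e 0≤e₀ halves zero    = ℚP.≤-reflexive (sym (ℚP.*-identityʳ (e 0)))
halving-bound e 0≤e₀ halves (suc n) = begin
  e (suc n)               ≡⟨ halves n ⟩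
  e n * ½                 ≤⟨ ℚP.*-monoʳ-≤-nonNeg ½ (halving-bound e 0≤e₀ halves n) ⟩
  e 0 * inv1+ n * ½       ≡⟨ ℚP.*-assoc (e 0) (inv1+ n) ½ ⟩
  e 0 * (inv1+ n * ½)     ≤⟨ ℚP.*-monoˡ-≤-nonNeg (e 0) {{ℚ.nonNegative 0≤e₀}} (inv1+-halve n) ⟩
  e 0 * inv1+ (suc n)     ∎

step⇒mono : ∀ {_≲_ : ℚ → ℚ → Set} → Reflexive _≲_ → Transitive _≲_ →
            (s : ℕ → ℚ) → (∀ n → s n ≲ s (suc n)) → ∀ {m n} → m ℕ.≤ n → s m ≲ s n
step⇒mono {_≲_} refl′ trans′ s step m≤n = go (ℕP.≤⇒≤′ m≤n)
  where
  go : ∀ {m n} → m ℕ.≤′ n → s m ≲ s n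
  go ℕ.≤′-refl          = refl′
  go (ℕ.≤′-step m≤′n) = trans′ (go m≤′n) (step _)

-- Bisection

module Bisection (f : ℚ → ℚ) {a b : ℚ} (K : ℚ) (a≤b : a ≤ b) (fa<0 : f a < 0ℚ) (0<fb : 0ℚ < f b)
                 (lipschitz : ∀ x y → a ≤ x → x ≤ y → y ≤ b → f y - f x ≤ K * (y - x)) where

  -- |K| + 1 is again a Lipschitz constant, and being at least 1 it makes error n bound width n too.
  K⁺ : ℚ
  K⁺ = ∣ K ∣ + 1ℚ

  1≤K⁺ : 1ℚ ≤ K⁺
  1≤K⁺ = subst (_≤ K⁺) (ℚP.+-identityˡ 1ℚ) (ℚP.+-monoˡ-≤ 1ℚ (ℚP.0≤∣p∣ K))

  0<K⁺ : 0ℚ < K⁺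
  0<K⁺ = ℚP.<-≤-trans (ℚP.positive⁻¹ 1ℚ) 1≤K⁺

  lipschitz⁺ : ∀ x y → a ≤ x → x ≤ y → y ≤ b → f y - f x ≤ K⁺ * (y - x)
  lipschitz⁺ x y a≤x x≤y y≤b = ℚP.≤-trans (lipschitz x y a≤x x≤y y≤b)
    (ℚP.*-monoʳ-≤-nonNeg (y - x) {{ℚ.nonNegative (p≤q⇒0≤q-p x≤y)}}
      (ℚP.≤-trans (p≤∣p∣ K) (p≤p+q (ℚP.nonNegative⁻¹ 1ℚ))))

  width : ℕ → ℚ
  width zero    = b - a
  width (suc n) = width n * ½

  0≤width : ∀ n → 0ℚ ≤ width n
  0≤width zero    = p≤q⇒0≤q-p a≤b
  0≤width (suc n) = 0≤p*q (0≤width n) (ℚP.nonNegative⁻¹ ½)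

  width-halves : ∀ n → width (suc n) + width (suc n) ≡ width n
  width-halves n = trans (sym (ℚP.*-distribˡ-+ (width n) ½ ½)) (ℚP.*-identityʳ (width n))

  lo : ℕ → ℚ
  lo zero    = a
  lo (suc n) with f (lo n + width (suc n)) ℚP.≤? 0ℚ
  ... | yes _ = lo n + width (suc n)
  ... | no  _ = lo n

  mid hi : ℕ → ℚ
  mid n = lo n + width (suc n)
  hi  n = lo n + width n

  lo-step : ∀ n → (lo (suc n) ≡ mid n × f (mid n) ≤ 0ℚ) ⊎ (lo (suc n) ≡ lo n × 0ℚ < f (mid n))
  lo-step n with f (mid n) ℚP.≤? 0ℚ
  ... | yes fm≤0 = inj₁ (refl , fm≤0)
  ... | no  fm≰0 = inj₂ (refl , ℚP.≰⇒> fm≰0)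

  hi-step-right : ∀ n → lo (suc n) ≡ mid n → hi (suc n) ≡ hi n
  hi-step-right n eq = begin-equality
    lo (suc n) + width (suc n)            ≡⟨ cong (_+ width (suc n)) eq ⟩
    lo n + width (suc n) + width (suc n)  ≡⟨ ℚP.+-assoc (lo n) (width (suc n)) (width (suc n)) ⟩
    lo n + (width (suc n) + width (suc n)) ≡⟨ cong (_+_ (lo n)) (width-halves n) ⟩
    hi n                                  ∎

  hi-step-left : ∀ n → lo (suc n) ≡ lo n → hi (suc n) ≡ mid n
  hi-step-left n eq = cong (_+ width (suc n)) eq

  mid≤hi : ∀ n → mid n ≤ hi n
  mid≤hi n = ℚP.+-monoʳ-≤ (lo n) (subst (width (suc n) ≤_) (width-halves n) (p≤p+q (0≤width (suc n))))

  lo≤lo-suc : ∀ n → lo n ≤ lo (suc n)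
  lo≤lo-suc n with lo-step n
  ... | inj₁ (eq , _) = subst (lo n ≤_) (sym eq) (p≤p+q (0≤width (suc n)))
  ... | inj₂ (eq , _) = ℚP.≤-reflexive (sym eq)

  hi-suc≤hi : ∀ n → hi (suc n) ≤ hi n
  hi-suc≤hi n with lo-step n
  ... | inj₁ (eq , _) = ℚP.≤-reflexive (hi-step-right n eq)
  ... | inj₂ (eq , _) = subst (_≤ hi n) (sym (hi-step-left n eq)) (mid≤hi n)

  signs : ∀ n → f (lo n) ≤ 0ℚ × 0ℚ < f (hi n)
  signs zero = ℚP.<⇒≤ fa<0 , subst (λ x → 0ℚ < f x) (sym a+[b-a]≡b) 0<fb
    where
    a+[b-a]≡b : a + (b - a) ≡ b
    a+[b-a]≡b = solve 2 (λ a b → a :+ (b :- a) := b) refl a b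
  signs (suc n) with lo-step n | signs n
  ... | inj₁ (eq , fm≤0) | _ , 0<fhi = subst (λ x → f x ≤ 0ℚ) (sym eq) fm≤0 ,
                                       subst (λ x → 0ℚ < f x) (sym (hi-step-right n eq)) 0<fhi
  ... | inj₂ (eq , 0<fm) | flo≤0 , _ = subst (λ x → f x ≤ 0ℚ) (sym eq) flo≤0 ,
                                       subst (λ x → 0ℚ < f x) (sym (hi-step-left n eq)) 0<fm

  lo-mono : ∀ {m n} → m ℕ.≤ n → lo m ≤ lo n
  lo-mono = step⇒mono {_≤_} ℚP.≤-refl ℚP.≤-trans lo lo≤lo-suc

  hi-antitone : ∀ {m n} → m ℕ.≤ n → hi n ≤ hi m
  hi-antitone = step⇒mono {flip _≤_} ℚP.≤-refl (flip ℚP.≤-trans) hi hi-suc≤hi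

  lo≤hi : ∀ n → lo n ≤ hi n
  lo≤hi n = p≤p+q (0≤width n)

  a≤lo : ∀ n → a ≤ lo n
  a≤lo n = lo-mono {0} {n} ℕ.z≤n

  hi≤b : ∀ n → hi n ≤ b
  hi≤b n = subst (hi n ≤_) (solve 2 (λ a b → a :+ (b :- a) := b) refl a b) (hi-antitone {0} {n} ℕ.z≤n)

  lo-close : ∀ {m n} → m ℕ.≤ n → ∣ lo m - lo n ∣ ≤ width m
  lo-close {m} {n} m≤n = p≤q≤p+d⇒∣p-q∣≤d {lo m} {lo n} {width m} (lo-mono m≤n) (ℚP.≤-trans (lo≤hi n) (hi-antitone m≤n))

  error : ℕ → ℚ
  error n = K⁺ * width n

  width≤error : ∀ n → width n ≤ error n
  width≤error n = subst (_≤ error n) (ℚP.*-identityˡ (width n))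
                    (ℚP.*-monoʳ-≤-nonNeg (width n) {{ℚ.nonNegative (0≤width n)}} 1≤K⁺)

  ∣f-lo∣≤error : ∀ n → ∣ f (lo n) ∣ ≤ error n
  ∣f-lo∣≤error n = begin
    ∣ f (lo n) ∣           ≡⟨ trans (sym (ℚP.∣-p∣≡∣p∣ (f (lo n)))) (ℚP.0≤p⇒∣p∣≡p (ℚP.neg-antimono-≤ flo≤0)) ⟩
    - f (lo n)             ≤⟨ subst (_≤ f (hi n) - f (lo n)) (ℚP.+-identityˡ (- f (lo n)))
                                (ℚP.+-monoˡ-≤ (- f (lo n)) (ℚP.<⇒≤ 0<fhi)) ⟩
    f (hi n) - f (lo n)    ≤⟨ lipschitz⁺ (lo n) (hi n) (a≤lo n) (lo≤hi n) (hi≤b n) ⟩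
    K⁺ * (hi n - lo n)     ≡⟨ cong (K⁺ *_) (solve 2 (λ l w → l :+ w :- l := w) refl (lo n) (width n)) ⟩
    error n                ∎
    where
    flo≤0 = proj₁ (signs n)
    0<fhi = proj₂ (signs n)

  error-halves : ∀ n → error (suc n) ≡ error n * ½
  error-halves n = sym (ℚP.*-assoc K⁺ (width n) ½)

  modulus : ℕ → ℕ
  modulus n = proj₁ (archimedean (error 0) (inv1+ n) (0<inv1+ n))

  error-modulus : ∀ n → error (modulus n) < inv1+ n
  error-modulus n = ℚP.≤-<-trans (halving-bound error (0≤p*q (ℚP.<⇒≤ 0<K⁺) (0≤width 0)) error-halves (modulus n))
                                 (proj₂ (archimedean (error 0) (inv1+ n) (0<inv1+ n)))

  width-modulus : ∀ n → width (modulus n) ≤ inv1+ n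
  width-modulus n = ℚP.≤-trans (width≤error (modulus n)) (ℚP.<⇒≤ (error-modulus n))

  regular : ∀ m n → ∣ lo (modulus m) - lo (modulus n) ∣ ≤ inv1+ m + inv1+ n
  regular m n = [ ordered , reversed ]′ (ℕP.≤-total (modulus m) (modulus n))
    where
    ordered : modulus m ℕ.≤ modulus n → ∣ lo (modulus m) - lo (modulus n) ∣ ≤ inv1+ m + inv1+ n
    ordered μm≤μn = begin
      ∣ lo (modulus m) - lo (modulus n) ∣ ≤⟨ lo-close μm≤μn ⟩
      width (modulus m)                   ≤⟨ width-modulus m ⟩
      inv1+ m                             ≤⟨ p≤p+q (ℚP.<⇒≤ (0<inv1+ n)) ⟩
      inv1+ m + inv1+ n                   ∎
    reversed : modulus n ℕ.≤ modulus m → ∣ lo (modulus m) - lo (modulus n) ∣ ≤ inv1+ m + inv1+ n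
    reversed μn≤μm = begin
      ∣ lo (modulus m) - lo (modulus n) ∣ ≡⟨ ∣p-q∣≡∣q-p∣ (lo (modulus m)) (lo (modulus n)) ⟩
      ∣ lo (modulus n) - lo (modulus m) ∣ ≤⟨ lo-close μn≤μm ⟩
      width (modulus n)                   ≤⟨ width-modulus n ⟩
      inv1+ n                             ≤⟨ p≤p+q (ℚP.<⇒≤ (0<inv1+ m)) ⟩
      inv1+ n + inv1+ m                   ≡⟨ ℚP.+-comm (inv1+ n) (inv1+ m) ⟩
      inv1+ m + inv1+ n                   ∎

  root : ℝ
  root = record { seq = λ n → lo (modulus n) ; reg = regular }

  is-root : IsRootOf f root
  is-root k = k , λ n k≤n → ℚP.≤-trans (∣f-lo∣≤error (modulus n))
                             (ℚP.≤-trans (ℚP.<⇒≤ (error-modulus n)) (inv1+-antitone k≤n))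

  -- 0 < f (hi i) forces K⁺ (hi i - a) > - f a, and hi i exceeds lo i by at most error i < v.
  a<root : a <ʳ root
  a<root = n , (begin-strict
    a + v           <⟨ ℚP.+-monoʳ-< a v<l-a ⟩
    a + (l - a)     ≡⟨ solve 2 (λ a l → a :+ (l :- a) := l) refl a l ⟩
    l               ∎)
    where
    n = proj₁ (archimedean (K⁺ + 1ℚ) (- f a) (ℚP.neg-antimono-< fa<0))
    i = modulus n
    l = lo i
    v = inv1+ n
    K⁺v<K⁺[l-a] : K⁺ * v < K⁺ * (l - a)
    K⁺v<K⁺[l-a] = begin-strict
      K⁺ * v                        ≡⟨ solve 2 (λ k v → k :* v := (k :+ num 1) :* v :- v) refl K⁺ v ⟩
      (K⁺ + 1ℚ) * v - v             <⟨ ℚP.+-monoˡ-< (- v) (proj₂ (archimedean (K⁺ + 1ℚ) (- f a) (ℚP.neg-antimono-< fa<0))) ⟩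
      - f a - v                     ≤⟨ ℚP.+-monoˡ-≤ (- v) (begin
        - f a                         ≤⟨ subst (_≤ f (hi i) - f a) (ℚP.+-identityˡ (- f a))
                                           (ℚP.+-monoˡ-≤ (- f a) (ℚP.<⇒≤ (proj₂ (signs i)))) ⟩
        f (hi i) - f a                ≤⟨ lipschitz⁺ a (hi i) ℚP.≤-refl (ℚP.≤-trans (a≤lo i) (lo≤hi i)) (hi≤b i) ⟩
        K⁺ * (hi i - a)               ≡⟨ solve 4 (λ k l w a → k :* (l :+ w :- a) := k :* (l :- a) :+ k :* w) refl K⁺ l (width i) a ⟩
        K⁺ * (l - a) + error i        ≤⟨ ℚP.+-monoʳ-≤ (K⁺ * (l - a)) (ℚP.<⇒≤ (error-modulus n)) ⟩
        K⁺ * (l - a) + v              ∎) ⟩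
      K⁺ * (l - a) + v - v          ≡⟨ solve 2 (λ x v → x :+ v :- v := x) refl (K⁺ * (l - a)) v ⟩
      K⁺ * (l - a)                  ∎
    v<l-a : v < l - a
    v<l-a = ℚP.*-cancelˡ-<-nonNeg K⁺ {{ℚ.nonNegative (ℚP.<⇒≤ 0<K⁺)}} K⁺v<K⁺[l-a]

  root<b : root ʳ< b
  root<b = n , (begin-strict
    l + v           <⟨ ℚP.+-monoʳ-< l v<b-l ⟩
    l + (b - l)     ≡⟨ solve 2 (λ l b → l :+ (b :- l) := b) refl l b ⟩
    b               ∎)
    where
    n = proj₁ (archimedean K⁺ (f b) 0<fb)
    i = modulus n
    l = lo i
    v = inv1+ n
    K⁺v<K⁺[b-l] : K⁺ * v < K⁺ * (b - l)
    K⁺v<K⁺[b-l] = begin-strict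
      K⁺ * v            <⟨ proj₂ (archimedean K⁺ (f b) 0<fb) ⟩
      f b               ≤⟨ subst (_≤ f b - f l) (ℚP.+-identityʳ (f b))
                             (ℚP.+-monoʳ-≤ (f b) (ℚP.neg-antimono-≤ (proj₁ (signs i)))) ⟩
      f b - f l         ≤⟨ lipschitz⁺ l b (a≤lo i) (ℚP.≤-trans (lo≤hi i) (hi≤b i)) ℚP.≤-refl ⟩
      K⁺ * (b - l)      ∎
    v<b-l : v < b - l
    v<b-l = ℚP.*-cancelˡ-<-nonNeg K⁺ {{ℚ.nonNegative (ℚP.<⇒≤ 0<K⁺)}} K⁺v<K⁺[b-l]

  root-between : Σ ℝ (λ t → IsRootOf f t × (a <ʳ t) × (t ʳ< b))
  root-between = root , is-root , a<root , root<b

-- Polynomials in Horner form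

horner : List ℚ → ℚ → ℚ
horner []       x = 0ℚ
horner (c ∷ cs) x = c + x * horner cs x

horner-bound : List ℚ → ℚ → ℚ
horner-bound []       M = 0ℚ
horner-bound (c ∷ cs) M = ∣ c ∣ + M * horner-bound cs M

lipschitz-constant : List ℚ → ℚ → ℚ
lipschitz-constant []       M = 0ℚ
lipschitz-constant (c ∷ cs) M = horner-bound cs M + M * lipschitz-constant cs M

∣horner∣≤horner-bound : ∀ cs {x M} → ∣ x ∣ ≤ M → ∣ horner cs x ∣ ≤ horner-bound cs M
∣horner∣≤horner-bound []       _      = ℚP.≤-refl
∣horner∣≤horner-bound (c ∷ cs) {x} {M} ∣x∣≤M = begin
  ∣ c + x * horner cs x ∣              ≤⟨ ℚP.∣p+q∣≤∣p∣+∣q∣ c (x * horner cs x) ⟩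
  ∣ c ∣ + ∣ x * horner cs x ∣          ≡⟨ cong (_+_ ∣ c ∣) (ℚP.∣p*q∣≡∣p∣*∣q∣ x (horner cs x)) ⟩
  ∣ c ∣ + ∣ x ∣ * ∣ horner cs x ∣      ≤⟨ ℚP.+-monoʳ-≤ ∣ c ∣ (*-mono-≤-nonNeg (ℚP.0≤∣p∣ x) (ℚP.0≤∣p∣ (horner cs x))
                                                          ∣x∣≤M (∣horner∣≤horner-bound cs ∣x∣≤M)) ⟩
  ∣ c ∣ + M * horner-bound cs M        ∎

horner-lipschitz : ∀ cs {x y M} → ∣ x ∣ ≤ M → ∣ y ∣ ≤ M →
                   ∣ horner cs y - horner cs x ∣ ≤ lipschitz-constant cs M * ∣ y - x ∣
horner-lipschitz []       {x} {y} _ _ = ℚP.≤-reflexive (sym (ℚP.*-zeroˡ ∣ y - x ∣))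
horner-lipschitz (c ∷ cs) {x} {y} {M} ∣x∣≤M ∣y∣≤M = begin
  ∣ (c + y * Hy) - (c + x * Hx) ∣            ≡⟨ cong ∣_∣ (solve 5 (λ c x y Hx Hy → (c :+ y :* Hy) :- (c :+ x :* Hx)
                                                  := y :* (Hy :- Hx) :+ (y :- x) :* Hx) refl c x y Hx Hy) ⟩
  ∣ y * (Hy - Hx) + (y - x) * Hx ∣           ≤⟨ ℚP.∣p+q∣≤∣p∣+∣q∣ (y * (Hy - Hx)) ((y - x) * Hx) ⟩
  ∣ y * (Hy - Hx) ∣ + ∣ (y - x) * Hx ∣       ≡⟨ cong₂ _+_ (ℚP.∣p*q∣≡∣p∣*∣q∣ y (Hy - Hx)) (ℚP.∣p*q∣≡∣p∣*∣q∣ (y - x) Hx) ⟩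
  ∣ y ∣ * ∣ Hy - Hx ∣ + ∣ y - x ∣ * ∣ Hx ∣   ≤⟨ ℚP.+-mono-≤
       (*-mono-≤-nonNeg (ℚP.0≤∣p∣ y) (ℚP.0≤∣p∣ (Hy - Hx)) ∣y∣≤M (horner-lipschitz cs ∣x∣≤M ∣y∣≤M))
       (ℚP.*-monoˡ-≤-nonNeg ∣ y - x ∣ {{ℚP.∣-∣-nonNeg (y - x)}} (∣horner∣≤horner-bound cs ∣x∣≤M)) ⟩
  M * (L * ∣ y - x ∣) + ∣ y - x ∣ * B        ≡⟨ solve 4 (λ M L d B → M :* (L :* d) :+ d :* B := (B :+ M :* L) :* d)
                                                  refl M L ∣ y - x ∣ B ⟩
  (B + M * L) * ∣ y - x ∣                    ∎
  where
  Hx = horner cs x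
  Hy = horner cs y
  B = horner-bound cs M
  L = lipschitz-constant cs M

horner-lipschitz-≤ : ∀ cs {x y M} → 0ℚ ≤ x → x ≤ y → y ≤ M →
                     horner cs y - horner cs x ≤ lipschitz-constant cs M * (y - x)
horner-lipschitz-≤ cs {x} {y} {M} 0≤x x≤y y≤M = begin
  horner cs y - horner cs x            ≤⟨ p≤∣p∣ (horner cs y - horner cs x) ⟩
  ∣ horner cs y - horner cs x ∣        ≤⟨ horner-lipschitz cs (∣p∣≤ 0≤x (ℚP.≤-trans x≤y y≤M)) (∣p∣≤ 0≤y y≤M) ⟩
  lipschitz-constant cs M * ∣ y - x ∣  ≡⟨ cong (_*_ (lipschitz-constant cs M)) (ℚP.0≤p⇒∣p∣≡p (p≤q⇒0≤q-p x≤y)) ⟩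
  lipschitz-constant cs M * (y - x)    ∎
  where
  0≤y = ℚP.≤-trans 0≤x x≤y
  ∣p∣≤ : ∀ {p q} → 0ℚ ≤ p → p ≤ q → ∣ p ∣ ≤ q
  ∣p∣≤ {p} {q} 0≤p p≤q = subst (_≤ q) (sym (ℚP.0≤p⇒∣p∣≡p 0≤p)) p≤q

0≤horner-ℕ : ∀ ks {x} → 0ℚ ≤ x → 0ℚ ≤ horner (List.map ℕ→ℚ ks) x
0≤horner-ℕ []       _   = ℚP.≤-refl
0≤horner-ℕ (k ∷ ks) 0≤x = ℚP.+-mono-≤ (0≤ℕ→ℚ k) (0≤p*q 0≤x (0≤horner-ℕ ks 0≤x))

constant-term : List ℕ → ℕ
constant-term []      = 0
constant-term (k ∷ _) = k

0<horner-ℕ : ∀ ks {x} → 0 ℕ.< constant-term ks → 0ℚ ≤ x → 0ℚ < horner (List.map ℕ→ℚ ks) x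
0<horner-ℕ (suc k ∷ ks) _ 0≤x = ℚP.+-mono-<-≤ (0<ℕ→ℚ k) (0≤p*q 0≤x (0≤horner-ℕ ks 0≤x))

hornerₚ : ∀ {n} → List (Polynomial n) → Polynomial n → Polynomial n
hornerₚ []       x = num 0
hornerₚ (c ∷ cs) x = c :+ x :* hornerₚ cs x

-- The polynomial Q

even-poly : ∀ {n} → (a₈ a₆ a₄ a₂ a₀ t : Polynomial n) → Polynomial n
even-poly a₈ a₆ a₄ a₂ a₀ t = t :^ 10 :+ a₈ :* t :^ 8 :+ a₆ :* t :^ 6 :- a₄ :* t :^ 4 :- a₂ :* t :^ 2 :- a₀

c₈ c₆ c₄ c₂ c₀ : ∀ {n} → Polynomial n → Polynomial n → Polynomial n
c₈ p q = (num 2 :* q :^ 2 :+ p :^ 2) :* (num 3 :* q :^ 2 :- num 2 :* p :^ 2)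
c₆ p q = q :^ 8 :+ num 10 :* p :^ 2 :* q :^ 6 :+ num 4 :* p :^ 4 :* q :^ 4 :- num 14 :* p :^ 6 :* q :^ 2 :+ p :^ 8
c₄ p q = p :^ 2 :* q :^ 2 :* (q :^ 8 :- num 14 :* p :^ 2 :* q :^ 6 :+ num 4 :* p :^ 4 :* q :^ 4
                               :+ num 10 :* p :^ 6 :* q :^ 2 :+ p :^ 8)
c₂ p q = p :^ 6 :* q :^ 6 :* (q :^ 2 :+ num 2 :* p :^ 2) :* (num 3 :* p :^ 2 :- num 2 :* q :^ 2)
c₀ p q = q :^ 10 :* p :^ 10

Q-poly : ∀ {n} → (p q t : Polynomial n) → Polynomial n
Q-poly p q t = even-poly (c₈ p q) (c₆ p q) (c₄ p q) (c₂ p q) (c₀ p q) t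

Q-rescaled : ∀ {n} → (s p q t : Polynomial n) → Polynomial n
Q-rescaled s p q t =
  even-poly (s :^ 2 :* c₈ p q) (s :^ 4 :* c₆ p q) (s :^ 6 :* c₄ p q) (s :^ 8 :* c₂ p q) (s :^ 10 :* c₀ p q) t

L-poly : ∀ {n} → (p q : Polynomial n) → Polynomial n
L-poly p q = p :^ 2 :+ num 2 :* q :* p :- num 2 :* q :^ 2

Q-coefficientsₚ : ∀ {n} → Polynomial n → Polynomial n → List (Polynomial n)
Q-coefficientsₚ p q =
  :- c₀ p q ∷ num 0 ∷ :- c₂ p q ∷ num 0 ∷ :- c₄ p q ∷ num 0 ∷ c₆ p q ∷ num 0 ∷ c₈ p q ∷ num 0 ∷ num 1 ∷ []

-- Qpq p q is definitionally Qℚ (ℕ→ℚ p) (ℕ→ℚ q): Q-poly follows Defs term by term.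
Qℚ : ℚ → ℚ → ℚ → ℚ
Qℚ p q t = ⟦ Q-poly (var (# 0)) (var (# 1)) (var (# 2)) ⟧ (p ∷ q ∷ t ∷ [])

Q̃ℚ : ℚ → ℚ → ℚ → ℚ → ℚ
Q̃ℚ s p q t = ⟦ Q-rescaled (var (# 0)) (var (# 1)) (var (# 2)) (var (# 3)) ⟧ (s ∷ p ∷ q ∷ t ∷ [])

Lℚ : ℚ → ℚ → ℚ
Lℚ p q = ⟦ L-poly (var (# 0)) (var (# 1)) ⟧ (p ∷ q ∷ [])

Q-coefficients : ℚ → ℚ → List ℚ
Q-coefficients p q = List.map (λ c → ⟦ c ⟧ (p ∷ q ∷ [])) (Q-coefficientsₚ (var (# 0)) (var (# 1)))

Q-horner : ∀ p q t → Qℚ p q t ≡ horner (Q-coefficients p q) t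
Q-horner p q t = ring-identity (Q-poly P Q T) (hornerₚ (Q-coefficientsₚ P Q) T) (p ∷ q ∷ t ∷ [])
  where
  P Q T : Polynomial 3
  P = var (# 0); Q = var (# 1); T = var (# 2)

Q-homogeneous : ∀ s p q t → Qℚ (s * p) (s * q) (s ^ᵠ 2 * t) ≡ s ^ᵠ 20 * Qℚ p q t
Q-homogeneous s p q t =
  ring-identity (Q-poly (S :* P) (S :* Q) (S :^ 2 :* T)) (S :^ 20 :* Q-poly P Q T) (s ∷ p ∷ q ∷ t ∷ [])
  where
  S P Q T : Polynomial 4
  S = var (# 0); P = var (# 1); Q = var (# 2); T = var (# 3)

Q-rescale : ∀ s p q t → Qℚ (s * p) (s * q) (s * t) ≡ s ^ᵠ 10 * Q̃ℚ s p q t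
Q-rescale s p q t =
  ring-identity (Q-poly (S :* P) (S :* Q) (S :* T)) (S :^ 10 :* Q-rescaled S P Q T) (s ∷ p ∷ q ∷ t ∷ [])
  where
  S P Q T : Polynomial 4
  S = var (# 0); P = var (# 1); Q = var (# 2); T = var (# 3)

L-homogeneous : ∀ s p q → Lℚ (s * p) (s * q) ≡ s ^ᵠ 2 * Lℚ p q
L-homogeneous s p q = ring-identity (L-poly (S :* P) (S :* Q)) (S :^ 2 :* L-poly P Q) (s ∷ p ∷ q ∷ [])
  where
  S P Q : Polynomial 3
  S = var (# 0); P = var (# 1); Q = var (# 2)

-- Coefficients, constant term first, of the polynomials in r to which Q reduces at the two ends
-- of the interval.
lower-coefficients : List ℕ
lower-coefficients =
  2030482921171167586501503520000 ∷ 545234579904735860600126636000 ∷ 68626106986582934582445284400 ∷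
  5374294607234820178948108800 ∷ 293096582154651489401758032 ∷ 11803437262989669103745792 ∷
  363092257268693415696896 ∷ 8702951078904435735744 ∷ 164265809036906374384 ∷ 2449645645442672512 ∷
  28766723410771968 ∷ 263219777131296 ∷ 1839743487200 ∷ 9495204864 ∷ 34127808 ∷ 76320 ∷ 80 ∷ []

upper-coefficients : List ℕ
upper-coefficients =
  958208395896219102349609728640611439242202319375 ∷ 417512101599022580766522092436815535214771884500 ∷
  87457996844190495228154385290855721345544886775 ∷ 11724504453441406241938948223661106238388059130 ∷
  1129670275808837287312476051795214817659957008 ∷ 83287141250094698962490004695687912609011990 ∷
  4884314619030118467623960141973274055644749 ∷ 233817550430733224542966173486448940184764 ∷
  9303919902443602718541970152578611054433 ∷ 311748775416652092545614289891287926184 ∷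
  8878628017090102745613914585722823483 ∷ 216345843929535781454134131534357490 ∷
  4530196185870995748979223057087353 ∷ 81722755524976376283834033697466 ∷ 1271107608954525802021811488280 ∷
  17032516547268852172932859938 ∷ 196128348112719349731377780 ∷ 1932246149593728046028034 ∷
  16180257389284762603221 ∷ 114092360996854666100 ∷ 668714845140981624 ∷ 3199415768127284 ∷
  12175785319588 ∷ 35455951032 ∷ 74206164 ∷ 99392 ∷ 64 ∷ []

L-expansion : ∀ r → Lℚ (ℕ→ℚ 59 + r) 1ℚ ≡ horner (List.map ℕ→ℚ (3597 ∷ 120 ∷ 1 ∷ [])) r
L-expansion r = ring-identity (L-poly (num 59 :+ R) (num 1)) (hornerₚ (List.map num (3597 ∷ 120 ∷ 1 ∷ [])) R) (r ∷ [])
  where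
  R : Polynomial 1
  R = var (# 0)

Q-expansion-lower : ∀ r → let A = ℕ→ℚ 59 + r in
                    Qℚ A 1ℚ (Lℚ A 1ℚ) ≡ - horner (List.map ℕ→ℚ lower-coefficients) r
Q-expansion-lower r =
  ring-identity (Q-poly A (num 1) (L-poly A (num 1))) (:- hornerₚ (List.map num lower-coefficients) R) (r ∷ [])
  where
  R A : Polynomial 1
  R = var (# 0)
  A = num 59 :+ R

Q-expansion-upper : ∀ r → let A = ℕ→ℚ 59 + r in
                    Q̃ℚ A A 1ℚ (A * Lℚ A 1ℚ + ℕ→ℚ 9) ≡ horner (List.map ℕ→ℚ upper-coefficients) r
Q-expansion-upper r =
  ring-identity (Q-rescaled A A (num 1) (A :* L-poly A (num 1) :+ num 9)) (hornerₚ (List.map num upper-coefficients) R) (r ∷ [])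
  where
  R A : Polynomial 1
  R = var (# 0)
  A = num 59 :+ R

0<59+r : ∀ {r} → 0ℚ ≤ r → 0ℚ < ℕ→ℚ 59 + r
0<59+r 0≤r = ℚP.+-mono-<-≤ (0<ℕ→ℚ 58) 0≤r

L-at-q[59+r] : ∀ q r → Lℚ (q * (ℕ→ℚ 59 + r)) q ≡ q ^ᵠ 2 * Lℚ (ℕ→ℚ 59 + r) 1ℚ
L-at-q[59+r] q r = begin-equality
  Lℚ (q * A) q                  ≡⟨ cong (Lℚ (q * A)) (sym (ℚP.*-identityʳ q)) ⟩
  Lℚ (q * A) (q * 1ℚ)           ≡⟨ L-homogeneous q A 1ℚ ⟩
  q ^ᵠ 2 * Lℚ A 1ℚ              ∎
  where
  A = ℕ→ℚ 59 + r

0≤L : ∀ {p q} → 0ℚ < q → ℕ→ℚ 59 * q ≤ p → 0ℚ ≤ Lℚ p q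
0≤L {q = q} 0<q 59q≤p = ratio-elim (λ p → 0ℚ ≤ Lℚ p q) (ℕ→ℚ 59) 0<q 59q≤p λ r 0≤r →
  subst (0ℚ ≤_) (sym (trans (L-at-q[59+r] q r) (cong (_*_ (q ^ᵠ 2)) (L-expansion r))))
    (0≤p*q (ℚP.<⇒≤ (0<p^n 2 0<q)) (0≤horner-ℕ (3597 ∷ 120 ∷ 1 ∷ []) 0≤r))

Q-at-L-expanded : ∀ q r → let p = q * (ℕ→ℚ 59 + r) in
                  Qℚ p q (Lℚ p q) ≡ - (q ^ᵠ 20 * horner (List.map ℕ→ℚ lower-coefficients) r)
Q-at-L-expanded q r = begin-equality
  Qℚ (q * A) q (Lℚ (q * A) q)            ≡⟨ cong₂ (Qℚ (q * A)) (sym (ℚP.*-identityʳ q)) (L-at-q[59+r] q r) ⟩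
  Qℚ (q * A) (q * 1ℚ) (q ^ᵠ 2 * Lℚ A 1ℚ) ≡⟨ Q-homogeneous q A 1ℚ (Lℚ A 1ℚ) ⟩
  q ^ᵠ 20 * Qℚ A 1ℚ (Lℚ A 1ℚ)           ≡⟨ cong (_*_ (q ^ᵠ 20)) (Q-expansion-lower r) ⟩
  q ^ᵠ 20 * - H                         ≡⟨ sym (ℚP.neg-distribʳ-* (q ^ᵠ 20) H) ⟩
  - (q ^ᵠ 20 * H)                       ∎
  where
  A = ℕ→ℚ 59 + r
  H = horner (List.map ℕ→ℚ lower-coefficients) r

Q-at-L<0 : ∀ {p q} → 0ℚ < q → ℕ→ℚ 59 * q ≤ p → Qℚ p q (Lℚ p q) < 0ℚ
Q-at-L<0 {q = q} 0<q 59q≤p = ratio-elim (λ p → Qℚ p q (Lℚ p q) < 0ℚ) (ℕ→ℚ 59) 0<q 59q≤p λ r 0≤r →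
  subst (_< 0ℚ) (sym (Q-at-L-expanded q r))
    (ℚP.neg-antimono-< (0<p*q (0<p^n 20 0<q) (0<horner-ℕ lower-coefficients ℕ.z<s 0≤r)))

-- Homogeneity with λ = p and then with λ = q² clears the denominator of d, after which the
-- rescaling by A turns Q into a polynomial in r.
Q-at-L+d-expanded : ∀ q r d → let A = ℕ→ℚ 59 + r; p = q * A in p * d ≡ ℕ→ℚ 9 * q ^ᵠ 3 →
  p ^ᵠ 20 * Qℚ p q (Lℚ p q + d) ≡ (q ^ᵠ 2) ^ᵠ 20 * (A ^ᵠ 10 * horner (List.map ℕ→ℚ upper-coefficients) r)
Q-at-L+d-expanded q r d pd≡9q³ = begin-equality
  p ^ᵠ 20 * Qℚ p q u                                     ≡⟨ sym (Q-homogeneous p p q u) ⟩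
  Qℚ (p * p) (p * q) (p ^ᵠ 2 * u)                        ≡⟨ cong₃ Qℚ pp pq p²u ⟩
  Qℚ (q ^ᵠ 2 * (A * A)) (q ^ᵠ 2 * (A * 1ℚ)) ((q ^ᵠ 2) ^ᵠ 2 * (A * s))
                                                         ≡⟨ Q-homogeneous (q ^ᵠ 2) (A * A) (A * 1ℚ) (A * s) ⟩
  (q ^ᵠ 2) ^ᵠ 20 * Qℚ (A * A) (A * 1ℚ) (A * s)          ≡⟨ cong (_*_ ((q ^ᵠ 2) ^ᵠ 20)) (Q-rescale A A 1ℚ s) ⟩
  (q ^ᵠ 2) ^ᵠ 20 * (A ^ᵠ 10 * Q̃ℚ A A 1ℚ s)               ≡⟨ cong (λ x → (q ^ᵠ 2) ^ᵠ 20 * (A ^ᵠ 10 * x)) (Q-expansion-upper r) ⟩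
  (q ^ᵠ 2) ^ᵠ 20 * (A ^ᵠ 10 * horner (List.map ℕ→ℚ upper-coefficients) r) ∎
  where
  A = ℕ→ℚ 59 + r
  p = q * A
  s = A * Lℚ A 1ℚ + ℕ→ℚ 9
  u = Lℚ p q + d
  cong₃ : ∀ (g : ℚ → ℚ → ℚ → ℚ) {x x′ y y′ z z′} → x ≡ x′ → y ≡ y′ → z ≡ z′ → g x y z ≡ g x′ y′ z′
  cong₃ g refl refl refl = refl
  pp : p * p ≡ q ^ᵠ 2 * (A * A)
  pp = solve 2 (λ q a → q :* a :* (q :* a) := q :^ 2 :* (a :* a)) refl q A
  pq : p * q ≡ q ^ᵠ 2 * (A * 1ℚ)
  pq = solve 2 (λ q a → q :* a :* q := q :^ 2 :* (a :* num 1)) refl q A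
  p²u : p ^ᵠ 2 * u ≡ (q ^ᵠ 2) ^ᵠ 2 * (A * s)
  p²u = begin-equality
    p ^ᵠ 2 * (Lℚ p q + d)                      ≡⟨ solve 3 (λ p l d → p :^ 2 :* (l :+ d) := p :^ 2 :* l :+ p :* (p :* d))
                                                     refl p (Lℚ p q) d ⟩
    p ^ᵠ 2 * Lℚ p q + p * (p * d)              ≡⟨ cong₂ (λ l x → p ^ᵠ 2 * l + p * x) (L-at-q[59+r] q r) pd≡9q³ ⟩
    p ^ᵠ 2 * (q ^ᵠ 2 * Lℚ A 1ℚ) + p * (ℕ→ℚ 9 * q ^ᵠ 3)
      ≡⟨ solve 3 (λ q a l → (q :* a) :^ 2 :* (q :^ 2 :* l) :+ q :* a :* (num 9 :* q :^ 3)
                            := (q :^ 2) :^ 2 :* (a :* (a :* l :+ num 9))) refl q A (Lℚ A 1ℚ) ⟩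
    (q ^ᵠ 2) ^ᵠ 2 * (A * s)                    ∎

Q-at-L+d>0 : ∀ {p q d} → 0ℚ < q → ℕ→ℚ 59 * q ≤ p → p * d ≡ ℕ→ℚ 9 * q ^ᵠ 3 → 0ℚ < Qℚ p q (Lℚ p q + d)
Q-at-L+d>0 {q = q} {d} 0<q 59q≤p =
  ratio-elim (λ p → p * d ≡ ℕ→ℚ 9 * q ^ᵠ 3 → 0ℚ < Qℚ p q (Lℚ p q + d)) (ℕ→ℚ 59) 0<q 59q≤p λ r 0≤r pd≡9q³ →
    0<p*q⇒0<q (ℚP.<⇒≤ (0<p^n 20 (0<p*q 0<q (0<59+r 0≤r))))
      (subst (0ℚ <_) (sym (Q-at-L+d-expanded q r d pd≡9q³))
        (0<p*q (0<p^n 20 (0<p^n 2 0<q)) (0<p*q (0<p^n 10 (0<59+r 0≤r)) (0<horner-ℕ upper-coefficients ℕ.z<s 0≤r))))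

theorem4p3 : (p q : ℕ) → .{{_ : NonZero p}} → .{{_ : NonZero q}} → Coprime p q → 59 ℕ.* q ℕ.≤ p →
    Σ ℝ (λ t → IsRootOf (Qpq p q) t × (lowerB p q <ʳ t) × (t ʳ< upperB p q))
theorem4p3 p q _ 59q≤p =
  Bisection.root-between (Qpq p q) K L≤U (Q-at-L<0 0<Q 59Q≤P) (Q-at-L+d>0 0<Q 59Q≤P Pd≡9Q³) lipschitz
  where
  P Q d U K : ℚ
  P = ℕ→ℚ p
  Q = ℕ→ℚ q
  d = (+ (9 ℕ.* q ℕ.^ 3)) / p
  U = upperB p q
  K = lipschitz-constant (Q-coefficients P Q) U
  0<Q : 0ℚ < Q
  0<Q = ℚP.positive⁻¹ Q {{ℚP.normalize-pos q 1}}
  59Q≤P : ℕ→ℚ 59 * Q ≤ P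
  59Q≤P = subst (_≤ P) (ℕ→ℚ-* 59 q) (ℕ→ℚ-mono-≤ 59q≤p)
  Pd≡9Q³ : P * d ≡ ℕ→ℚ 9 * Q ^ᵠ 3
  Pd≡9Q³ = trans (ℕ→ℚ-*-/ (9 ℕ.* q ℕ.^ 3) p) (trans (ℕ→ℚ-* 9 (q ℕ.^ 3)) (cong (_*_ (ℕ→ℚ 9)) (ℕ→ℚ-^ q 3)))
  L≤U : lowerB p q ≤ U
  L≤U = p≤p+q (ℚP.nonNegative⁻¹ d {{ℚP.normalize-nonNeg (9 ℕ.* q ℕ.^ 3) p}})
  lipschitz : ∀ x y → lowerB p q ≤ x → x ≤ y → y ≤ U → Qpq p q y - Qpq p q x ≤ K * (y - x)
  lipschitz x y L≤x x≤y y≤U =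
    subst₂ (λ fy fx → fy - fx ≤ K * (y - x)) (sym (Q-horner P Q y)) (sym (Q-horner P Q x))
      (horner-lipschitz-≤ (Q-coefficients P Q) (ℚP.≤-trans (0≤L 0<Q 59Q≤P) L≤x) x≤y y≤U)
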